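{- Let $\alpha\in\mathcal{S}_r$ and $\beta\in\mathcal{S}_s$ be Grassmanian permutations with no fixed points. Then there exist a Grassmanian permutation $\pi\in\mathcal{S}_{r+s}$ and a partition $[r+s]=A\sqcup B$ with $|A|=r$, $|B|=s$, $\pi(A)=A$, $\pi(B)=B$, such that the restriction of $\pi$ to $A$ is isomorphic to $\alpha$ and the restriction of $\pi$ to $B$ is isomorphic to $\beta$.
   Context: $\mathcal{S}_m$ is the symmetric group on $[m]=\{1,\dots,m\}$. For $\pi\in\mathcal{S}_m$, $\operatorname{des}(\pi)$ is the number of $i\in[m-1]$ with $\pi(i)>\pi(i+1)$; $\pi$ is Grassmanian if $\operatorname{des}(\pi)\le 1$. If $\pi(A)=A$ for $A\subseteq[m]$ with $|A|=r$, the restriction of $\pi$ to $A$ is isomorphic to $\alpha\in\mathcal{S}_r$ if $\pi\circ\phi=\phi\circ\alpha$, where $\phi:[r]\to A$ is the unique order-preserving bijection. -}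

module Defs where

open import Data.Nat using (ℕ; zero; suc; _+_; _≤_; _<_)
open import Data.Fin using (Fin; toℕ; inject₁) renaming (suc to fsuc; _<_ to _<ᶠ_)
open import Data.Fin.Permutation using (Permutation′; _⟨$⟩ʳ_)
open import Data.Fin.Subset using (Subset; _∈_; _∉_; ∣_∣; ∁)
open import Data.Product using (Σ; _×_; ∃)
open import Data.List using (List; length; filter; allFin)
open import Data.Vec using (Vec)
open import Relation.Binary.PropositionalEquality using (_≡_; _≢_)
open import Relation.Nullary using (¬_)
open import Function.Bundles using (_⇔_)

-- positions i ∈ {0,…,m-2} (i.e. i and i+1 in 0-based Fin m)
-- number of descents: #{ i : π(i) > π(i+1) }
des : ∀ {m} → Permutation′ m → ℕ
des {zero} π = 0
des {suc m} π = length (filter (λ i → toℕ (π ⟨$⟩ʳ fsuc i) Data.Nat.<? toℕ (π ⟨$⟩ʳ inject₁ i)) (allFin m))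
  where import Data.Nat

Grassmannian : ∀ {m} → Permutation′ m → Set
Grassmannian π = des π ≤ 1

FixedPointFree : ∀ {m} → Permutation′ m → Set
FixedPointFree {m} π = (i : Fin m) → π ⟨$⟩ʳ i ≢ i

Stable : ∀ {m} → Permutation′ m → Subset m → Set
Stable {m} π A = (i : Fin m) → (i ∈ A ⇔ (π ⟨$⟩ʳ i) ∈ A)

OrderIsoOnto : ∀ {r m} → (Fin r → Fin m) → Subset m → Set
OrderIsoOnto {r} {m} φ A =
  ((i j : Fin r) → i <ᶠ j → φ i <ᶠ φ j)
  × ((i : Fin r) → φ i ∈ A)
  × ((a : Fin m) → a ∈ A → Σ (Fin r) (λ i → φ i ≡ a))

-- the restriction of π to A is isomorphic to α :
-- π ∘ φ = φ ∘ α, with φ the unique order-preserving bijection [r] → A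
RestrictionIso : ∀ {m r} → Permutation′ m → Subset m → Permutation′ r → Set
RestrictionIso {m} {r} π A α =
  (φ : Fin r → Fin m) → OrderIsoOnto φ A →
  (i : Fin r) → π ⟨$⟩ʳ (φ i) ≡ φ (α ⟨$⟩ʳ i)

-- A Grassmannian permutation is increasing on two consecutive runs of positions, i.e. on the
-- classes of a monotone Boolean labelling of the positions (before/after its descent).  Let
-- σ = α ⊕ β act on [r] ⊔ [s], each point labelled by the run it lies in for α or for β, and order
-- the points lexicographically by their itineraries (the label sequences along their σ-orbits),
-- ties broken by position.  Along this order labels are monotone, σ preserves the order between
-- points of equal label, and each of [r] and [s] keeps its natural order.  Relabelling [r + s] along the
-- order therefore conjugates σ into a Grassmannian π whose invariant blocks, the images of [r] and
-- [s], carry copies of α and β.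

module Submission where

open import Defs
open import Data.Bool as B using (Bool; true; false; if_then_else_; b≤b; f≤t; f<t)
import Data.Bool.Properties as B
open import Data.Bool.Properties using (¬-not; not-¬)
open import Data.Fin as F using (Fin; zero; suc; toℕ; inject₁; punchOut; splitAt; join; _↑ˡ_; _↑ʳ_)
open import Data.Fin.Induction using (<-wellFounded)
open import Data.Fin.Permutation
  using (Permutation′; _⟨$⟩ʳ_; _⟨$⟩ˡ_; permutation; inverseˡ; inverseʳ; flip; _∘ₚ_)
open import Data.Fin.Properties as F
  using (any?; injective⇒≤; punchOut-injective; 0≢1+n; toℕ-inject₁; pigeonhole; +↔⊎;
         splitAt-↑ˡ; splitAt-↑ʳ; splitAt⁻¹-↑ˡ; splitAt⁻¹-↑ʳ; toℕ-↑ˡ; toℕ-↑ʳ)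
open import Data.Fin.Subset using (Subset; _∈_; ∁; ∣_∣)
open import Data.Fin.Subset.Properties using (x∈∁p⇒x∉p; x∉p⇒x∈∁p; ∣∁p∣≡n∸∣p∣)
open import Data.List using (List; []; _∷_; length; filter; tabulate; allFin)
import Data.List.Membership.Propositional as List
open import Data.List.Membership.Propositional.Properties using (∈-allFin)
open import Data.List.Properties using (filter-some; filter-none; filter-notAll; length-tabulate)
open import Data.List.Relation.Binary.Lex.Strict as Lex using (Lex-<; base; this; next)
open import Data.List.Relation.Binary.Pointwise using (Pointwise; []; _∷_)
open import Data.List.Relation.Unary.Any as Any using (here; there)
import Data.List.Relation.Unary.All.Properties as Allₚ
import Data.List.Relation.Unary.Any.Properties as Anyₚ
open import Data.Nat as ℕ using (ℕ; zero; suc; _+_; _*_; _∸_; _!; z≤n; s≤s)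
open import Data.Nat.Divisibility using (divides; ∣-trans; m∣m*n; m≤n⇒m!∣n!)
open import Data.Nat.GeneralisedArithmetic using (iterate)
open import Data.Nat.Properties as ℕ using (<⇒≱; 1+n≰n; _!≢0)
open import Algebra.Properties.CommutativeMonoid.Sum ℕ.+-0-commutativeMonoid
  using (sum; sum-permute; sum-cong-≗; sum-replicate-zero)
open import Data.Product using (Σ; ∃; _×_; _,_; proj₁; proj₂)
open import Data.Product.Relation.Binary.Lex.Strict using (×-strictTotalOrder)
open import Data.Sum as Sum using (_⊎_; inj₁; inj₂; [_,_]′)
open import Data.Sum.Function.Propositional using (_⊎-↔_)
import Data.Vec as Vec
open import Data.Vec.Properties using (lookup∘tabulate; []=⇒lookup; lookup⇒[]=)
open import Function using (id; const; _∘_; case_of_)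
open import Function.Bundles using (_⇔_; mk⇔; Equivalence)
open import Function.Construct.Composition using (_↔-∘_)
open import Function.Construct.Symmetry using (↔-sym)
open import Function.Definitions using (Injective; Surjective)
open import Induction.WellFounded using (module All)
open import Relation.Binary using (StrictTotalOrder; _Preserves_⟶_; tri<; tri≈; tri>)
open import Relation.Binary.PropositionalEquality
open import Relation.Nullary using (Dec; yes; no; does; ¬_; contradiction)
open import Relation.Nullary.Decidable using (_×-dec_; dec-true; dec-false)
open import Relation.Unary using (Pred; Decidable; _⊆_)

module _ {a p} {A : Set a} {P : Pred A p} (P? : Decidable P) where

  length-filter≤1⇒unique : ∀ {m} (f : Fin m → A) → length (filter P? (tabulate f)) ℕ.≤ 1 →
                           ∀ {i j} → P (f i) → P (f j) → i ≡ j
  length-filter≤1⇒unique {suc m} f ≤1 {i} {j} pᵢ pⱼ with P? (f zero)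
  ... | yes _ = trans (only-zero pᵢ) (sym (only-zero pⱼ))
    where
    only-zero : ∀ {k} → P (f k) → k ≡ zero
    only-zero {zero}  _  = refl
    only-zero {suc k} pₖ = contradiction ≤1 (<⇒≱ (s≤s (filter-some P? (Anyₚ.tabulate⁺ k pₖ))))
  length-filter≤1⇒unique {suc m} f ≤1 {zero}  {_}     p₀ _  | no ¬p₀ = contradiction p₀ ¬p₀
  length-filter≤1⇒unique {suc m} f ≤1 {suc _} {zero}  _  p₀ | no ¬p₀ = contradiction p₀ ¬p₀
  length-filter≤1⇒unique {suc m} f ≤1 {suc _} {suc _} pᵢ pⱼ | no _ =
    cong suc (length-filter≤1⇒unique (f ∘ suc) ≤1 pᵢ pⱼ)

  unique⇒length-filter≤1 : ∀ {m} (f : Fin m → A) → (∀ {i j} → P (f i) → P (f j) → i ≡ j) →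
                           length (filter P? (tabulate f)) ℕ.≤ 1
  unique⇒length-filter≤1 {zero}  f unique = z≤n
  unique⇒length-filter≤1 {suc m} f unique with P? (f zero)
  ... | yes p₀ =
    s≤s (ℕ.≤-reflexive (cong length (filter-none P? (Allₚ.tabulate⁺ {f = f ∘ suc} rest-rejected))))
    where
    rest-rejected : ∀ i → ¬ P (f (suc i))
    rest-rejected i pᵢ = 0≢1+n (unique p₀ pᵢ)
  ... | no  _  = unique⇒length-filter≤1 (f ∘ suc) λ pᵢ pⱼ → F.suc-injective (unique pᵢ pⱼ)

module _ {a p q} {A : Set a} {P : Pred A p} {Q : Pred A q} (P? : Decidable P) (Q? : Decidable Q)
         (P⊆Q : P ⊆ Q) where

  length-filter-mono : ∀ xs → length (filter P? xs) ℕ.≤ length (filter Q? xs)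
  length-filter-mono []       = z≤n
  length-filter-mono (x ∷ xs) with P? x | Q? x
  ... | yes _  | yes _  = s≤s (length-filter-mono xs)
  ... | yes px | no ¬qx = contradiction (P⊆Q px) ¬qx
  ... | no  _  | yes _  = ℕ.m≤n⇒m≤1+n (length-filter-mono xs)
  ... | no  _  | no  _  = length-filter-mono xs

  length-filter-< : ∀ {w xs} → w List.∈ xs → Q w → ¬ P w →
                    length (filter P? xs) ℕ.< length (filter Q? xs)
  length-filter-< {xs = x ∷ xs} (here refl) qx ¬px with P? x | Q? x
  ... | yes px | _      = contradiction px ¬px
  ... | no  _  | yes _  = s≤s (length-filter-mono xs)
  ... | no  _  | no ¬qx = contradiction qx ¬qx
  length-filter-< {xs = x ∷ xs} (there w∈xs) qw ¬pw with P? x | Q? x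
  ... | yes _  | yes _  = s≤s (length-filter-< w∈xs qw ¬pw)
  ... | yes px | no ¬qx = contradiction (P⊆Q px) ¬qx
  ... | no  _  | yes _  = ℕ.m≤n⇒m≤1+n (length-filter-< w∈xs qw ¬pw)
  ... | no  _  | no  _  = length-filter-< w∈xs qw ¬pw

⟨$⟩ʳ-injective : ∀ {n} (π : Permutation′ n) → Injective _≡_ _≡_ (π ⟨$⟩ʳ_)
⟨$⟩ʳ-injective π {x} {y} eq = begin
  x                      ≡⟨ inverseˡ π ⟨
  π ⟨$⟩ˡ (π ⟨$⟩ʳ x)     ≡⟨ cong (π ⟨$⟩ˡ_) eq ⟩
  π ⟨$⟩ˡ (π ⟨$⟩ʳ y)     ≡⟨ inverseˡ π ⟩
  y                      ∎
  where open ≡-Reasoning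

injective⇒surjective : ∀ {n} {f : Fin n → Fin n} → Injective _≡_ _≡_ f → Surjective _≡_ _≡_ f
injective⇒surjective {suc n} {f} f-inj y with any? (λ x → f x F.≟ y)
... | yes (x , fx≡y) = x , λ { refl → fx≡y }
... | no  ∄x         = contradiction (injective⇒≤ punchOut∘f-injective) 1+n≰n
  where
  y≢f : ∀ x → y ≢ f x
  y≢f x y≡fx = ∄x (x , sym y≡fx)
  punchOut∘f-injective : Injective _≡_ _≡_ (λ x → punchOut (y≢f x))
  punchOut∘f-injective eq = f-inj (punchOut-injective (y≢f _) (y≢f _) eq)

fromInjective : ∀ {n} {f : Fin n → Fin n} → Injective _≡_ _≡_ f → Permutation′ n
fromInjective {f = f} f-inj = permutation f (proj₁ ∘ surj) (λ y → proj₂ (surj y) refl)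
                                          (λ x → f-inj (proj₂ (surj (f x)) refl))
  where surj = injective⇒surjective f-inj

iterate-+ : ∀ {a} {A : Set a} (f : A → A) a b x → iterate f x (a + b) ≡ iterate f (iterate f x a) b
iterate-+ f zero    b x = refl
iterate-+ f (suc a) b x = iterate-+ f a b (f x)

iterate-* : ∀ {a} {A : Set a} (f : A → A) {p x} → iterate f x p ≡ x → ∀ q → iterate f x (q * p) ≡ x
iterate-* f         fᵖx≡x zero    = refl
iterate-* f {p} {x} fᵖx≡x (suc q) = begin
  iterate f x (p + q * p)            ≡⟨ iterate-+ f p (q * p) x ⟩
  iterate f (iterate f x p) (q * p)  ≡⟨ cong (λ y → iterate f y (q * p)) fᵖx≡x ⟩
  iterate f x (q * p)                ≡⟨ iterate-* f fᵖx≡x q ⟩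
  x                                  ∎
  where open ≡-Reasoning

module _ {n} {f : Fin n → Fin n} (f-inj : Injective _≡_ _≡_ f) where

  iterate-injective : ∀ t {x y} → iterate f x t ≡ iterate f y t → x ≡ y
  iterate-injective zero    eq = eq
  iterate-injective (suc t) eq = f-inj (iterate-injective t eq)

  iterate-returns : ∀ x → ∃ λ p → 0 ℕ.< p × p ℕ.≤ n × iterate f x p ≡ x
  iterate-returns x with pigeonhole (ℕ.n<1+n n) (λ (t : Fin (suc n)) → iterate f x (toℕ t))
  ... | i , j , i<j , fⁱx≡fʲx = p , ℕ.m<n⇒0<n∸m i<j , p≤n , sym (iterate-injective (toℕ i) fⁱx≡fⁱfᵖx)
    where
    p = toℕ j ∸ toℕ i

    p≤n : p ℕ.≤ n
    p≤n = ℕ.≤-trans (ℕ.m∸n≤m (toℕ j) (toℕ i)) (F.toℕ≤pred[n] j)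

    fⁱx≡fⁱfᵖx : iterate f x (toℕ i) ≡ iterate f (iterate f x p) (toℕ i)
    fⁱx≡fⁱfᵖx = begin
      iterate f x (toℕ i)                 ≡⟨ fⁱx≡fʲx ⟩
      iterate f x (toℕ j)                 ≡⟨ cong (iterate f x) (ℕ.m+[n∸m]≡n (ℕ.<⇒≤ i<j)) ⟨
      iterate f x (toℕ i + p)             ≡⟨ cong (iterate f x) (ℕ.+-comm (toℕ i) p) ⟩
      iterate f x (p + toℕ i)             ≡⟨ iterate-+ f p (toℕ i) x ⟩
      iterate f (iterate f x p) (toℕ i)   ∎
      where open ≡-Reasoning

  iterate-n! : ∀ x → iterate f x (n !) ≡ x
  iterate-n! x with iterate-returns x
  ... | p@(suc p′) , _ , p≤n , fᵖx≡x with ∣-trans (m∣m*n {p} (p′ !)) (m≤n⇒m!∣n! p≤n)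
  ...   | divides q n!≡q*p rewrite n!≡q*p = iterate-* f fᵖx≡x q

increasing-run : ∀ {m} (f : Fin (suc m) → ℕ) {i j} → i F.< j →
                 (∀ d → i F.≤ inject₁ d → suc d F.≤ j → f (inject₁ d) ℕ.< f (suc d)) → f i ℕ.< f j
increasing-run {zero}  f {zero}  {zero}        ()
increasing-run {suc m} f {zero}  {suc zero}    _         step = step zero z≤n ℕ.≤-refl
increasing-run {suc m} f {zero}  {suc (suc j)} _         step =
  ℕ.<-trans (step zero z≤n (s≤s z≤n))
            (increasing-run (f ∘ suc) {zero} {suc j} (s≤s z≤n) λ d _ d<j → step (suc d) z≤n (s≤s d<j))
increasing-run {suc m} f {suc i} {suc j}       (s≤s i<j) step =
  increasing-run (f ∘ suc) i<j λ d i≤d d<j → step (suc d) (s≤s i≤d) (s≤s d<j)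

Descent : ∀ {m} → Permutation′ (suc m) → Fin m → Set
Descent π d = π ⟨$⟩ʳ suc d F.< π ⟨$⟩ʳ inject₁ d

-- Phrased with ℕ._<?_ so that filtering with it is literally the count in the definition of des.
descent? : ∀ {m} (π : Permutation′ (suc m)) → Decidable (Descent π)
descent? π d = toℕ (π ⟨$⟩ʳ suc d) ℕ.<? toℕ (π ⟨$⟩ʳ inject₁ d)

inject₁<suc : ∀ {m} (d : Fin m) → inject₁ d F.< suc d
inject₁<suc d = F.≤̄⇒inject₁< F.≤-refl

¬descent⇒ascent : ∀ {m} (π : Permutation′ (suc m)) d → ¬ Descent π d → π ⟨$⟩ʳ inject₁ d F.< π ⟨$⟩ʳ suc d
¬descent⇒ascent π d ¬δ = F.≤∧≢⇒< (ℕ.≮⇒≥ ¬δ) (F.<⇒≢ (inject₁<suc d) ∘ ⟨$⟩ʳ-injective π)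

record TwoRuns {m} (π : Permutation′ m) : Set where
  field
    inSecondRun      : Fin m → Bool
    inSecondRun-mono : inSecondRun Preserves F._≤_ ⟶ B._≤_
    ascending        : ∀ {i j} → i F.< j → inSecondRun i ≡ inSecondRun j → π ⟨$⟩ʳ i F.< π ⟨$⟩ʳ j

private
  ≤∧≢⇒< : ∀ {u v} → u B.≤ v → u ≢ v → u B.< v
  ≤∧≢⇒< b≤b u≢v = contradiction refl u≢v
  ≤∧≢⇒< f≤t _   = f<t

  <⇒≤ : ∀ {u v} → u B.< v → u B.≤ v
  <⇒≤ f<t = f≤t

  ≤⇒≯ : ∀ {u v} → u B.≤ v → ¬ v B.< u
  ≤⇒≯ b≤b ()
  ≤⇒≯ f≤t ()

  no-two-steps : ∀ {u v w z} → u B.< v → v B.≤ w → ¬ w B.< z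
  no-two-steps f<t () f<t

  suc≤inject₁ : ∀ {m} {d d′ : Fin m} → d F.< d′ → suc d F.≤ inject₁ d′
  suc≤inject₁ {d′ = d′} d<d′ = subst (ℕ._≤_ _) (sym (toℕ-inject₁ d′)) d<d′

twoRuns⇒grassmannian : ∀ {m} {π : Permutation′ m} → TwoRuns π → Grassmannian π
twoRuns⇒grassmannian {zero}      _    = z≤n
twoRuns⇒grassmannian {suc m} {π} runs = unique⇒length-filter≤1 (descent? π) id descent-unique
  where
  open TwoRuns runs

  descent⇒step : ∀ {d} → Descent π d → inSecondRun (inject₁ d) B.< inSecondRun (suc d)
  descent⇒step {d} δ = ≤∧≢⇒< (inSecondRun-mono (ℕ.<⇒≤ (inject₁<suc d)))
                                 (F.<-asym δ ∘ ascending (inject₁<suc d))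

  descent-unique : ∀ {d d′} → Descent π d → Descent π d′ → d ≡ d′
  descent-unique {d} {d′} δ δ′ with F.<-cmp d d′
  ... | tri< d<d′ _ _ = contradiction (descent⇒step δ′)
                          (no-two-steps (descent⇒step δ) (inSecondRun-mono (suc≤inject₁ d<d′)))
  ... | tri≈ _ d≡d′ _ = d≡d′
  ... | tri> _ _ d′<d = contradiction (descent⇒step δ)
                          (no-two-steps (descent⇒step δ′) (inSecondRun-mono (suc≤inject₁ d′<d)))

grassmannian⇒twoRuns : ∀ {m} {π : Permutation′ m} → Grassmannian π → TwoRuns π
grassmannian⇒twoRuns {zero}      _ = record
  { inSecondRun = λ () ; inSecondRun-mono = λ { {()} } ; ascending = λ { {()} } }
grassmannian⇒twoRuns {suc m} {π} g = record
  { inSecondRun = inSecondRun ; inSecondRun-mono = inSecondRun-mono ; ascending = ascending }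
  where
  descent-unique : ∀ {d d′} → Descent π d → Descent π d′ → d ≡ d′
  descent-unique = length-filter≤1⇒unique (descent? π) id g

  DescentBefore : Fin (suc m) → Fin m → Set
  DescentBefore i d = Descent π d × inject₁ d F.< i

  descentBefore? : ∀ i → Dec (∃ (DescentBefore i))
  descentBefore? i = any? λ d → descent? π d ×-dec (inject₁ d F.<? i)

  inSecondRun : Fin (suc m) → Bool
  inSecondRun i = does (descentBefore? i)

  inSecondRun-mono : inSecondRun Preserves F._≤_ ⟶ B._≤_
  inSecondRun-mono {i} {j} i≤j with descentBefore? i
  ... | no  _             = B.≤-minimum _
  ... | yes (d , δ , d<i) =
    B.≤-reflexive (sym (dec-true (descentBefore? j) (d , δ , ℕ.<-≤-trans d<i i≤j)))

  no-descent-within-run : ∀ {i j d} → inSecondRun i ≡ inSecondRun j →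
                          i F.≤ inject₁ d → suc d F.≤ j → ¬ Descent π d
  no-descent-within-run {i} {j} {d} same i≤d d<j δ = contradiction (begin
    false          ≡⟨ dec-false (descentBefore? i) none-before-i ⟨
    inSecondRun i  ≡⟨ same ⟩
    inSecondRun j  ≡⟨ dec-true (descentBefore? j) (d , δ , ℕ.<-≤-trans (inject₁<suc d) d<j) ⟩
    true           ∎) λ ()
    where
    open ≡-Reasoning
    none-before-i : ¬ ∃ (DescentBefore i)
    none-before-i (d′ , δ′ , d′<i) =
      F.<-irrefl (cong inject₁ (descent-unique δ′ δ)) (ℕ.<-≤-trans d′<i i≤d)

  ascending : ∀ {i j} → i F.< j → inSecondRun i ≡ inSecondRun j → π ⟨$⟩ʳ i F.< π ⟨$⟩ʳ j
  ascending i<j same = increasing-run (toℕ ∘ (π ⟨$⟩ʳ_)) i<j λ d i≤d d<j →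
    ¬descent⇒ascent π d (no-descent-within-run same i≤d d<j)

module Ranking {n c ℓ₁ ℓ₂} (O : StrictTotalOrder c ℓ₁ ℓ₂) (key : Fin n → StrictTotalOrder.Carrier O)
               (key-injective : ∀ {x y} → StrictTotalOrder._≈_ O (key x) (key y) → x ≡ y) where

  open StrictTotalOrder O using (_<_; _<?_; compare; irrefl; module Eq)
    renaming (trans to <-trans)

  infix 4 _≺_
  _≺_ : Fin n → Fin n → Set ℓ₂
  x ≺ y = key x < key y

  private
    _≺?_ : ∀ x y → Dec (x ≺ y)
    x ≺? y = key x <? key y

    #smaller : Fin n → ℕ
    #smaller x = length (filter (_≺? x) (allFin n))

    #smaller<n : ∀ x → #smaller x ℕ.< n
    #smaller<n x = subst (#smaller x ℕ.<_) (length-tabulate id)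
      (filter-notAll (_≺? x) (allFin n) (Any.map (λ { refl → irrefl Eq.refl }) (∈-allFin x)))

  rank : Fin n → Fin n
  rank x = F.fromℕ< (#smaller<n x)

  rank-mono : ∀ {x y} → x ≺ y → rank x F.< rank y
  rank-mono {x} {y} x≺y rewrite F.toℕ-fromℕ< (#smaller<n x) | F.toℕ-fromℕ< (#smaller<n y) =
    length-filter-< (_≺? x) (_≺? y) (λ z≺x → <-trans z≺x x≺y) (∈-allFin x) x≺y (irrefl Eq.refl)

  rank-injective : Injective _≡_ _≡_ rank
  rank-injective {x} {y} rx≡ry with compare (key x) (key y)
  ... | tri< x≺y _ _ = contradiction rx≡ry (F.<⇒≢ (rank-mono x≺y))
  ... | tri≈ _ kx≈ky _ = key-injective kx≈ky
  ... | tri> _ _ y≺x = contradiction (sym rx≡ry) (F.<⇒≢ (rank-mono y≺x))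

  ranking : Permutation′ n
  ranking = fromInjective rank-injective

  unrank : Fin n → Fin n
  unrank = ranking ⟨$⟩ˡ_

  unrank-mono : ∀ {p q} → p F.< q → unrank p ≺ unrank q
  unrank-mono {p} {q} p<q with compare (key (unrank p)) (key (unrank q))
  ... | tri< ≺ _ _ = ≺
  ... | tri≈ _ ≈ _ = contradiction (begin
          p                 ≡⟨ inverseʳ ranking ⟨
          rank (unrank p)   ≡⟨ cong rank (key-injective ≈) ⟩
          rank (unrank q)   ≡⟨ inverseʳ ranking ⟩
          q                 ∎) (F.<⇒≢ p<q)
    where open ≡-Reasoning
  ... | tri> _ _ ≻ = contradiction (subst₂ F._<_ (inverseʳ ranking) (inverseʳ ranking) (rank-mono ≻))
                                   (F.<-asym p<q)

private
  mono⇒reflects : ∀ {r m} {f : Fin r → Fin m} → (∀ i j → i F.< j → f i F.< f j) →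
                  ∀ {i j} → f i F.< f j → i F.< j
  mono⇒reflects f-mono {i} {j} fi<fj with F.<-cmp i j
  ... | tri< i<j _ _ = i<j
  ... | tri≈ _ refl _ = contradiction fi<fj (F.<-irrefl refl)
  ... | tri> _ _ j<i = contradiction (f-mono _ _ j<i) (F.<-asym fi<fj)

orderIsoOnto-unique : ∀ {r m} {φ ψ : Fin r → Fin m} {A : Subset m} →
                      OrderIsoOnto φ A → OrderIsoOnto ψ A → ∀ i → φ i ≡ ψ i
orderIsoOnto-unique {r} {m} {φ} {ψ} {A} isoφ isoψ = All.wfRec <-wellFounded _ (λ i → φ i ≡ ψ i) step
  where
  no-earlier-gap : ∀ {φ ψ : Fin r → Fin m} → OrderIsoOnto φ A → OrderIsoOnto ψ A →
                   ∀ {i} → (∀ {j} → j F.< i → φ j ≡ ψ j) → ¬ φ i F.< ψ i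
  no-earlier-gap {φ} {ψ} (φ-mono , φ∈A , _) (ψ-mono , _ , ψ-onto) {i} agree φi<ψi
    with ψ-onto (φ i) (φ∈A i)
  ... | j , ψj≡φi = F.<-irrefl (trans (agree j<i) ψj≡φi) (φ-mono j i j<i)
    where j<i = mono⇒reflects ψ-mono (subst (F._< ψ i) (sym ψj≡φi) φi<ψi)

  step : ∀ i → (∀ {j} → j F.< i → φ j ≡ ψ j) → φ i ≡ ψ i
  step i agree with F.<-cmp (φ i) (ψ i)
  ... | tri< φi<ψi _ _ = contradiction φi<ψi (no-earlier-gap isoφ isoψ agree)
  ... | tri≈ _ φi≡ψi _ = φi≡ψi
  ... | tri> _ _ ψi<φi = contradiction ψi<φi (no-earlier-gap isoψ isoφ (sym ∘ agree))

restrictionIso : ∀ {m r} {π : Permutation′ m} {A : Subset m} {α : Permutation′ r} {ψ : Fin r → Fin m} →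
                 OrderIsoOnto ψ A → (∀ i → π ⟨$⟩ʳ ψ i ≡ ψ (α ⟨$⟩ʳ i)) → RestrictionIso π A α
restrictionIso {π = π} {α = α} {ψ} isoψ commutes φ isoφ i = begin
  π ⟨$⟩ʳ φ i            ≡⟨ cong (π ⟨$⟩ʳ_) (φ≗ψ i) ⟩
  π ⟨$⟩ʳ ψ i            ≡⟨ commutes i ⟩
  ψ (α ⟨$⟩ʳ i)          ≡⟨ φ≗ψ (α ⟨$⟩ʳ i) ⟨
  φ (α ⟨$⟩ʳ i)          ∎
  where open ≡-Reasoning
        φ≗ψ = orderIsoOnto-unique isoφ isoψ

indicator : Bool → ℕ
indicator b = if b then 1 else 0

∣tabulate∣≡∑ : ∀ {n} (h : Fin n → Bool) → ∣ Vec.tabulate h ∣ ≡ sum (indicator ∘ h)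
∣tabulate∣≡∑ {zero}  h = refl
∣tabulate∣≡∑ {suc n} h with h zero
... | true  = cong suc (∣tabulate∣≡∑ (h ∘ suc))
... | false = ∣tabulate∣≡∑ (h ∘ suc)

∈-tabulate : ∀ {n} (h : Fin n → Bool) {x} → x ∈ Vec.tabulate h ⇔ h x ≡ true
∈-tabulate h {x} = mk⇔ (λ x∈ → trans (sym (lookup∘tabulate h x)) ([]=⇒lookup x∈))
                       (λ hx → lookup⇒[]= x _ (trans (lookup∘tabulate h x) hx))

∈-∁-tabulate : ∀ {n} (h : Fin n → Bool) {x} → x ∈ ∁ (Vec.tabulate h) ⇔ h x ≡ false
∈-∁-tabulate h = mk⇔ (λ x∈∁ → ¬-not (x∈∁p⇒x∉p x∈∁ ∘ Equivalence.from (∈-tabulate h)))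
                     (λ hx → x∉p⇒x∈∁p (not-¬ hx ∘ Equivalence.to (∈-tabulate h)))

stable-tabulate : ∀ {n} {π : Permutation′ n} (h : Fin n → Bool) → (∀ x → h (π ⟨$⟩ʳ x) ≡ h x) →
                  Stable π (Vec.tabulate h)
stable-tabulate h h-inv x = mk⇔ (λ x∈ → from (trans (h-inv x) (to x∈)))
                                (λ πx∈ → from (trans (sym (h-inv x)) (to πx∈)))
  where open module ∈h {y} = Equivalence (∈-tabulate h {y})

stable-∁ : ∀ {n} {π : Permutation′ n} {A : Subset n} → Stable π A → Stable π (∁ A)
stable-∁ A-stable x = mk⇔ (λ x∈∁A → x∉p⇒x∈∁p (x∈∁p⇒x∉p x∈∁A ∘ from))
                          (λ πx∈∁A → x∉p⇒x∈∁p (x∈∁p⇒x∉p πx∈∁A ∘ to))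
  where open Equivalence (A-stable x)

module Itineraries {n} (σ : Permutation′ n) (label : Fin n → Bool)
                   (σ-ascending : ∀ {x y} → x F.< y → label x ≡ label y → σ ⟨$⟩ʳ x F.< σ ⟨$⟩ʳ y) where

  itinerary : ℕ → Fin n → List Bool
  itinerary zero    x = []
  itinerary (suc d) x = label x ∷ itinerary d (σ ⟨$⟩ʳ x)

  _<ᴵ_ : List Bool → List Bool → Set
  _<ᴵ_ = Lex-< _≡_ B._<_

  _≋_ : List Bool → List Bool → Set
  _≋_ = Pointwise _≡_

  itinerary-<-suc : ∀ d {x y} → itinerary d x <ᴵ itinerary d y →
                    itinerary (suc d) x <ᴵ itinerary (suc d) y
  itinerary-<-suc zero    (base ())
  itinerary-<-suc (suc d) (this lt)    = this lt
  itinerary-<-suc (suc d) (next eq lt) = next eq (itinerary-<-suc d lt)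

  itinerary-≋-suc : ∀ d {x y} → itinerary d x ≋ itinerary d y →
                    label (iterate (σ ⟨$⟩ʳ_) x d) ≡ label (iterate (σ ⟨$⟩ʳ_) y d) →
                    itinerary (suc d) x ≋ itinerary (suc d) y
  itinerary-≋-suc zero    []        eq = eq ∷ []
  itinerary-≋-suc (suc d) (eq ∷ es) eq′ = eq ∷ itinerary-≋-suc d es eq′

  -- Itineraries are n!-periodic, so two of them that agree up to depth n! agree forever; this is
  -- what lets σ respect the order below between points with equal labels.
  private
    period : ℕ
    period = ℕ.pred (n !)

    periodic : ∀ x → iterate (σ ⟨$⟩ʳ_) x (suc period) ≡ x
    periodic x = subst (λ t → iterate (σ ⟨$⟩ʳ_) x t ≡ x) (sym (ℕ.suc-pred (n !) {{n !≢0}}))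
                       (iterate-n! (⟨$⟩ʳ-injective σ) x)

    key : Fin n → List Bool × Fin n
    key x = itinerary (suc period) x , x

    lexOrder : StrictTotalOrder _ _ _
    lexOrder = ×-strictTotalOrder (Lex.<-strictTotalOrder B.<-strictTotalOrder) (F.<-strictTotalOrder n)

  open Ranking lexOrder key proj₂ public

  label-mono : ∀ {x y} → x ≺ y → label x B.≤ label y
  label-mono (inj₁ (this lt))    = <⇒≤ lt
  label-mono (inj₁ (next eq _))  = B.≤-reflexive eq
  label-mono (inj₂ (eq ∷ _ , _)) = B.≤-reflexive eq

  σ-mono : ∀ {x y} → label x ≡ label y → x ≺ y → σ ⟨$⟩ʳ x ≺ σ ⟨$⟩ʳ y
  σ-mono     same (inj₁ (this lt))   = contradiction lt (B.<-irrefl same)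
  σ-mono     same (inj₁ (next _ lt)) = inj₁ (itinerary-<-suc period lt)
  σ-mono {x} {y} same (inj₂ (_ ∷ es , x<y)) =
    inj₂ (itinerary-≋-suc period es (begin
      label (iterate (σ ⟨$⟩ʳ_) x (suc period))  ≡⟨ cong label (periodic x) ⟩
      label x                                  ≡⟨ same ⟩
      label y                                  ≡⟨ cong label (periodic y) ⟨
      label (iterate (σ ⟨$⟩ʳ_) y (suc period))  ∎) , σ-ascending x<y same)
    where open ≡-Reasoning

  -- _∘ₚ_ composes left to right: conjugate ⟨$⟩ʳ p = rank (σ ⟨$⟩ʳ unrank p).
  conjugate : Permutation′ n
  conjugate = flip ranking ∘ₚ σ ∘ₚ ranking

  conjugate-grassmannian : Grassmannian conjugate
  conjugate-grassmannian = twoRuns⇒grassmannian record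
    { inSecondRun      = label ∘ unrank
    ; inSecondRun-mono = λ p≤q → case ℕ.m≤n⇒m<n∨m≡n p≤q of λ where
        (inj₁ p<q) → label-mono (unrank-mono p<q)
        (inj₂ p≡q) → B.≤-reflexive (cong (label ∘ unrank) (F.toℕ-injective p≡q))
    ; ascending        = λ p<q same → rank-mono (σ-mono same (unrank-mono p<q))
    }

  module Blocks (side : Fin n → Bool) (side-σ : ∀ x → side (σ ⟨$⟩ʳ x) ≡ side x)
                (label-mono-on-side : ∀ {x y} → side x ≡ side y → x F.< y → label x B.≤ label y) where

    itinerary-≼ : ∀ d {x y} → side x ≡ side y → x F.< y →
                  itinerary d x <ᴵ itinerary d y ⊎ itinerary d x ≋ itinerary d y
    itinerary-≼ zero    _    _   = inj₂ []
    itinerary-≼ (suc d) {x} {y} same x<y with B.<-cmp (label x) (label y)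
    ... | tri< lt _ _ = inj₁ (this lt)
    ... | tri≈ _ eq _ = Sum.map (next eq) (eq ∷_)
                          (itinerary-≼ d (trans (side-σ x) (trans same (sym (side-σ y))))
                                         (σ-ascending x<y eq))
    ... | tri> _ _ gt = contradiction gt (≤⇒≯ (label-mono-on-side same x<y))

    <⇒≺ : ∀ {x y} → side x ≡ side y → x F.< y → x ≺ y
    <⇒≺ {x} {y} same x<y = Sum.map₂ (_, x<y) (itinerary-≼ (suc period) same x<y)

    block : Subset n
    block = Vec.tabulate (side ∘ unrank)

    block-stable : Stable conjugate block
    block-stable = stable-tabulate {π = conjugate} (side ∘ unrank) λ p →
      trans (cong side (inverseˡ ranking)) (side-σ (unrank p))

    ∁block-stable : Stable conjugate (∁ block)
    ∁block-stable = stable-∁ {π = conjugate} block-stable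

    ∣block∣ : ∣ block ∣ ≡ sum (indicator ∘ side)
    ∣block∣ = trans (∣tabulate∣≡∑ (side ∘ unrank))
                    (sym (sum-permute (indicator ∘ side) (flip ranking)))

    restrictionIso-block : ∀ {k b} {C : Subset n} {γ : Permutation′ k} (e : Fin k → Fin n) →
                           (∀ i j → i F.< j → e i F.< e j) → (∀ i → side (e i) ≡ b) →
                           (∀ x → side x ≡ b → ∃ λ i → e i ≡ x) →
                           (∀ {p} → p ∈ C ⇔ side (unrank p) ≡ b) →
                           (∀ i → σ ⟨$⟩ʳ e i ≡ e (γ ⟨$⟩ʳ i)) → RestrictionIso conjugate C γ
    restrictionIso-block {C = C} {γ} e e-mono side-e e-onto ∈C σ-e =
      restrictionIso {π = conjugate} {α = γ} (ψ-mono , ψ∈C , ψ-onto) commutes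
      where
      ψ-mono : ∀ i j → i F.< j → rank (e i) F.< rank (e j)
      ψ-mono i j i<j = rank-mono (<⇒≺ (trans (side-e i) (sym (side-e j))) (e-mono i j i<j))
      ψ∈C : ∀ i → rank (e i) ∈ C
      ψ∈C i = Equivalence.from ∈C (trans (cong side (inverseˡ ranking)) (side-e i))
      ψ-onto : ∀ p → p ∈ C → ∃ λ i → rank (e i) ≡ p
      ψ-onto p p∈C with e-onto (unrank p) (Equivalence.to ∈C p∈C)
      ... | i , eᵢ≡ = i , trans (cong rank eᵢ≡) (inverseʳ ranking)
      commutes : ∀ i → conjugate ⟨$⟩ʳ rank (e i) ≡ rank (e (γ ⟨$⟩ʳ i))
      commutes i = cong rank (trans (cong (σ ⟨$⟩ʳ_) (inverseˡ ranking)) (σ-e i))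

_⊕_ : ∀ {r s} → Permutation′ r → Permutation′ s → Permutation′ (r + s)
α ⊕ β = ↔-sym +↔⊎ ↔-∘ ((α ⊎-↔ β) ↔-∘ +↔⊎)

module _ {r s} (α : Permutation′ r) (β : Permutation′ s) where

  ⊕-↑ˡ : ∀ i → (α ⊕ β) ⟨$⟩ʳ (i ↑ˡ s) ≡ (α ⟨$⟩ʳ i) ↑ˡ s
  ⊕-↑ˡ i = cong (join r s ∘ Sum.map (α ⟨$⟩ʳ_) (β ⟨$⟩ʳ_)) (splitAt-↑ˡ r i s)

  ⊕-↑ʳ : ∀ j → (α ⊕ β) ⟨$⟩ʳ (r ↑ʳ j) ≡ r ↑ʳ (β ⟨$⟩ʳ j)
  ⊕-↑ʳ j = cong (join r s ∘ Sum.map (α ⟨$⟩ʳ_) (β ⟨$⟩ʳ_)) (splitAt-↑ʳ r s j)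

data Split (r s : ℕ) : Fin (r + s) → Set where
  left  : ∀ i → Split r s (i ↑ˡ s)
  right : ∀ j → Split r s (r ↑ʳ j)

split : ∀ r {s} x → Split r s x
split r {s} x with splitAt r x in eq
... | inj₁ i = subst (Split r s) (splitAt⁻¹-↑ˡ eq) (left i)
... | inj₂ j = subst (Split r s) (splitAt⁻¹-↑ʳ eq) (right j)

module _ {r : ℕ} (s : ℕ) {i j : Fin r} where

  ↑ˡ-mono : i F.< j → i ↑ˡ s F.< j ↑ˡ s
  ↑ˡ-mono = subst₂ ℕ._<_ (sym (toℕ-↑ˡ i s)) (sym (toℕ-↑ˡ j s))

  ↑ˡ-reflects : i ↑ˡ s F.< j ↑ˡ s → i F.< j
  ↑ˡ-reflects = subst₂ ℕ._<_ (toℕ-↑ˡ i s) (toℕ-↑ˡ j s)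

module _ (r : ℕ) {s : ℕ} {i j : Fin s} where

  ↑ʳ-mono : i F.< j → r ↑ʳ i F.< r ↑ʳ j
  ↑ʳ-mono = subst₂ ℕ._<_ (sym (toℕ-↑ʳ r i)) (sym (toℕ-↑ʳ r j)) ∘ ℕ.+-monoʳ-< r

  ↑ʳ-reflects : r ↑ʳ i F.< r ↑ʳ j → i F.< j
  ↑ʳ-reflects = ℕ.+-cancelˡ-< r _ _ ∘ subst₂ ℕ._<_ (toℕ-↑ʳ r i) (toℕ-↑ʳ r j)

↑ˡ<↑ʳ : ∀ {r s} (i : Fin r) (j : Fin s) → i ↑ˡ s F.< r ↑ʳ j
↑ˡ<↑ʳ {r} {s} i j = subst₂ ℕ._<_ (sym (toℕ-↑ˡ i s)) (sym (toℕ-↑ʳ r j))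
                           (ℕ.<-≤-trans (F.toℕ<n i) (ℕ.m≤m+n r (toℕ j)))

isLeft : ∀ r {s} → Fin (r + s) → Bool
isLeft r = [ const true , const false ]′ ∘ splitAt r

isLeft-↑ˡ : ∀ {r} s (i : Fin r) → isLeft r (i ↑ˡ s) ≡ true
isLeft-↑ˡ {r} s i = cong [ const true , const false ]′ (splitAt-↑ˡ r i s)

isLeft-↑ʳ : ∀ r {s} (j : Fin s) → isLeft r (r ↑ʳ j) ≡ false
isLeft-↑ʳ r {s} j = cong [ const true , const false ]′ (splitAt-↑ʳ r s j)

sum-isLeft : ∀ r s → sum (indicator ∘ isLeft r {s}) ≡ r
sum-isLeft zero    s = sum-replicate-zero s
sum-isLeft (suc r) s = cong suc (trans (sum-cong-≗ (cong indicator ∘ isLeft-suc)) (sum-isLeft r s))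
  where
  isLeft-suc : ∀ x → isLeft (suc r) (suc x) ≡ isLeft r x
  isLeft-suc x with splitAt r x
  ... | inj₁ _ = refl
  ... | inj₂ _ = refl

module Merge {r s} {α : Permutation′ r} {β : Permutation′ s}
             (α-runs : TwoRuns α) (β-runs : TwoRuns β) where

  open TwoRuns

  label : Fin (r + s) → Bool
  label = [ inSecondRun α-runs , inSecondRun β-runs ]′ ∘ splitAt r

  private
    label-↑ˡ : ∀ i → label (i ↑ˡ s) ≡ inSecondRun α-runs i
    label-↑ˡ i = cong [ inSecondRun α-runs , inSecondRun β-runs ]′ (splitAt-↑ˡ r i s)

    label-↑ʳ : ∀ j → label (r ↑ʳ j) ≡ inSecondRun β-runs j
    label-↑ʳ j = cong [ inSecondRun α-runs , inSecondRun β-runs ]′ (splitAt-↑ʳ r s j)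

    left≢right : ∀ {i : Fin r} {j : Fin s} → isLeft r (i ↑ˡ s) ≢ isLeft r (r ↑ʳ j)
    left≢right {i} {j} same with () ← trans (sym (isLeft-↑ˡ s i)) (trans same (isLeft-↑ʳ r j))

  ⊕-ascending : ∀ {x y} → x F.< y → label x ≡ label y → (α ⊕ β) ⟨$⟩ʳ x F.< (α ⊕ β) ⟨$⟩ʳ y
  ⊕-ascending {x} {y} x<y same with split r x | split r y
  ... | left i  | left i′  rewrite ⊕-↑ˡ α β i | ⊕-↑ˡ α β i′ =
    ↑ˡ-mono s (ascending α-runs (↑ˡ-reflects s x<y)
                                (trans (sym (label-↑ˡ i)) (trans same (label-↑ˡ i′))))
  ... | left i  | right j′ rewrite ⊕-↑ˡ α β i | ⊕-↑ʳ α β j′ = ↑ˡ<↑ʳ _ _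
  ... | right j | left i′  = contradiction x<y (F.<-asym (↑ˡ<↑ʳ i′ j))
  ... | right j | right j′ rewrite ⊕-↑ʳ α β j | ⊕-↑ʳ α β j′ =
    ↑ʳ-mono r (ascending β-runs (↑ʳ-reflects r x<y)
                                (trans (sym (label-↑ʳ j)) (trans same (label-↑ʳ j′))))

  label-mono-on-side : ∀ {x y} → isLeft r x ≡ isLeft r y → x F.< y → label x B.≤ label y
  label-mono-on-side {x} {y} same x<y with split r x | split r y
  ... | left i  | left i′  rewrite label-↑ˡ i | label-↑ˡ i′ =
    inSecondRun-mono α-runs (ℕ.<⇒≤ (↑ˡ-reflects s x<y))
  ... | left i  | right j′ = contradiction same left≢right
  ... | right j | left i′  = contradiction (sym same) left≢right
  ... | right j | right j′ rewrite label-↑ʳ j | label-↑ʳ j′ =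
    inSecondRun-mono β-runs (ℕ.<⇒≤ (↑ʳ-reflects r x<y))

  isLeft-⊕ : ∀ x → isLeft r ((α ⊕ β) ⟨$⟩ʳ x) ≡ isLeft r x
  isLeft-⊕ x with split r x
  ... | left i  rewrite ⊕-↑ˡ α β i = trans (isLeft-↑ˡ s (α ⟨$⟩ʳ i)) (sym (isLeft-↑ˡ s i))
  ... | right j rewrite ⊕-↑ʳ α β j = trans (isLeft-↑ʳ r (β ⟨$⟩ʳ j)) (sym (isLeft-↑ʳ r j))

  open Itineraries (α ⊕ β) label ⊕-ascending public
  open Blocks (isLeft r {s}) isLeft-⊕ label-mono-on-side public

  ∣block∣≡r : ∣ block ∣ ≡ r
  ∣block∣≡r = trans ∣block∣ (sum-isLeft r s)

  ∣∁block∣≡s : ∣ ∁ block ∣ ≡ s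
  ∣∁block∣≡s = trans (∣∁p∣≡n∸∣p∣ block) (trans (cong (r + s ∸_) ∣block∣≡r) (ℕ.m+n∸m≡n r s))

  left-restriction : RestrictionIso conjugate block α
  left-restriction =
    restrictionIso-block {C = block} {α} (_↑ˡ s) (λ _ _ → ↑ˡ-mono s) (isLeft-↑ˡ s) onto
                         (∈-tabulate (isLeft r {s} ∘ unrank)) (⊕-↑ˡ α β)
    where
    onto : ∀ x → isLeft r x ≡ true → ∃ λ i → i ↑ˡ s ≡ x
    onto x isLeft-x with split r x
    ... | left i  = i , refl
    ... | right j with () ← trans (sym isLeft-x) (isLeft-↑ʳ r j)

  right-restriction : RestrictionIso conjugate (∁ block) β
  right-restriction =
    restrictionIso-block {C = ∁ block} {β} (r ↑ʳ_) (λ _ _ → ↑ʳ-mono r) (isLeft-↑ʳ r) onto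
                         (∈-∁-tabulate (isLeft r {s} ∘ unrank)) (⊕-↑ʳ α β)
    where
    onto : ∀ x → isLeft r x ≡ false → ∃ λ j → r ↑ʳ j ≡ x
    onto x isRight-x with split r x
    ... | right j = j , refl
    ... | left i  with () ← trans (sym isRight-x) (isLeft-↑ˡ s i)

lemma3p4 : (r s : ℕ) (α : Permutation′ r) (β : Permutation′ s) →
    Grassmannian α → FixedPointFree α →
    Grassmannian β → FixedPointFree β →
    Σ (Permutation′ (r + s)) (λ π → Grassmannian π ×
      Σ (Subset (r + s)) (λ A → ∣ A ∣ ≡ r × ∣ ∁ A ∣ ≡ s ×
        Stable π A × Stable π (∁ A) ×
        RestrictionIso π A α × RestrictionIso π (∁ A) β))
lemma3p4 r s α β α-grassmannian _ β-grassmannian _ =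
  conjugate , conjugate-grassmannian ,
  block , ∣block∣≡r , ∣∁block∣≡s , block-stable , ∁block-stable , left-restriction , right-restriction
  where
  open Merge (grassmannian⇒twoRuns {π = α} α-grassmannian) (grassmannian⇒twoRuns {π = β} β-grassmannian)
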